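{- Let $G=(V,E)$ be a finite undirected graph and $T$ a rooted spanning tree of $G$ with root $r_T$. For any vertex set $A\subset V$, either $A$ or $V\setminus A$ is equal to $\bigoplus_{v\in S}v^{\downarrow T}$ for some set $S\subseteq V\setminus\{r_T\}$.
   Context: For $v\in V$, $v^{\downarrow T}$ is the set of descendants of $v$ in $T$, including $v$ itself. $\bigoplus$ denotes iterated symmetric difference: $a\in\bigoplus_{i}A_i$ iff $a$ belongs to an odd number of the sets $A_i$. -}

module Defs where

open import Data.Nat using (ℕ; zero; suc)
open import Data.Bool using (Bool; true; false; _xor_; _∧_; _∨_; if_then_else_)
open import Data.Fin using (Fin; _≟_)
open import Data.Fin.Subset using (Subset; ⊥; _∈_; _∉_)
open import Data.Vec using (Vec; tabulate; zipWith; foldr; allFin; lookup)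
open import Data.Product using (Σ; ∃; _×_)
open import Data.Empty using () renaming (⊥ to Empty)
open import Relation.Nullary using (¬_; does)
open import Relation.Binary.PropositionalEquality using (_≡_)
open import Function using (_∘_)

record Graph (n : ℕ) : Set₁ where
  field
    Adj   : Fin n → Fin n → Set
    sym   : ∀ {u v} → Adj u v → Adj v u
    irrefl : ∀ {v} → ¬ Adj v v

iter : {A : Set} → (A → A) → ℕ → A → A
iter f zero    x = x
iter f (suc k) x = f (iter f k x)

-- A rooted spanning tree T of G, given by its root and parent map:
-- the tree edges are {v , parent v} for v ≠ root, each an edge of G,
-- and every vertex reaches the root by following parents.
record RootedSpanningTree {n : ℕ} (G : Graph n) : Set where
  field
    root       : Fin n
    parent     : Fin n → Fin n
    parent-root : parent root ≡ root
    tree-edge  : ∀ v → ¬ (v ≡ root) → Graph.Adj G v (parent v)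
    reaches-root : ∀ v → ∃ λ k → iter parent k v ≡ root

-- "w is a descendant of v" : v lies on the tree path from w to the root,
-- i.e. parent^k w ≡ v for some k; since that path has at most n vertices,
-- checking k = 0 , … , n-1 suffices.
isAncestorWithin : ∀ {n} → (Fin n → Fin n) → ℕ → Fin n → Fin n → Bool
isAncestorWithin par zero    v w = false
isAncestorWithin par (suc k) v w = does (iter par k w ≟ v) ∨ isAncestorWithin par k v w

desc : ∀ {n} {G : Graph n} → RootedSpanningTree G → Fin n → Subset n
desc {n} T v = tabulate (isAncestorWithin (RootedSpanningTree.parent T) n v)

_⊕_ : ∀ {n} → Subset n → Subset n → Subset n
_⊕_ = zipWith _xor_

⨁desc : ∀ {n} {G : Graph n} → RootedSpanningTree G → Subset n → Subset n
⨁desc {n} T S = foldr _ (λ v acc → (if lookup S v then desc T v else ⊥) ⊕ acc) ⊥ (allFin n)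

-- Take S to be the set of non-root vertices v with A(v) ≠ A(parent v); the root
-- is never in S since it is its own parent. A vertex w lies in v^{↓T} exactly when
-- v is on the tree path w, parent w, …, r, and these vertices are distinct, so
-- w ∈ ⨁_{v∈S} v^{↓T} has the parity of Σ (A(u) ⊕ A(parent u)) over u on that
-- path. The sum telescopes to A(w) ⊕ A(r): the symmetric difference is A when
-- r ∉ A and V ∖ A when r ∈ A.
module Submission where

open import Defs
open import Algebra.Bundles using (CommutativeRing)
open import Data.Bool using (Bool; true; false; not; _xor_; _∧_; if_then_else_)
open import Data.Bool.Properties
  using (xor-∧-commutativeRing; xor-assoc; xor-comm; xor-same; xor-identityʳ; true-xor; ∧-zeroʳ; ∧-identityʳ; ∧-distribˡ-xor)
open import Data.Empty using (⊥-elim)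
open import Data.Fin using (Fin; zero; suc; toℕ; _≟_)
open import Data.Fin.Properties using (pigeonhole; toℕ≤pred[n])
open import Data.Fin.Subset using (Subset; ⊥; ∁; _∉_)
open import Data.Nat using (ℕ; zero; suc; _+_; _*_; _∸_; _≤_; _<_)
open import Data.Nat.Properties using (m∸n+n≡m; m≤m*n; m≤m+n; m≤n⇒m≤1+n; n<1+n; +-suc)
open import Data.Product using (∃; _×_; _,_; proj₁; proj₂)
open import Data.Sum using (_⊎_; inj₁; inj₂)
open import Data.Vec using (Vec; foldr; tabulate; lookup)
open import Data.Vec.Properties
  using (lookup∘tabulate; tabulate∘lookup; tabulate-cong; lookup-map; lookup-replicate; lookup-zipWith; []=⇒lookup)
open import Function using (_∘_)
open import Relation.Nullary using (¬_; does; yes; no)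
open import Relation.Binary.PropositionalEquality using (_≡_; refl; sym; trans; cong; cong₂; module ≡-Reasoning)

open import Algebra.Properties.Semiring.Sum (CommutativeRing.semiring xor-∧-commutativeRing)
  using (sum-syntax; ∑-distrib-+; sum-replicate-zero; sum-cong-≗)

open ≡-Reasoning

iter-+ : ∀ {A : Set} (f : A → A) m k x → iter f (m + k) x ≡ iter f m (iter f k x)
iter-+ f zero    k x = refl
iter-+ f (suc m) k x = cong f (iter-+ f m k x)

iter-periodic : ∀ {A : Set} (f : A → A) {d y} → iter f d y ≡ y → ∀ t → iter f (t * d) y ≡ y
iter-periodic f         fᵈy≡y zero    = refl
iter-periodic f {d} {y} fᵈy≡y (suc t) = begin
  iter f (d + t * d) y        ≡⟨ iter-+ f d (t * d) y ⟩
  iter f d (iter f (t * d) y) ≡⟨ cong (iter f d) (iter-periodic f fᵈy≡y t) ⟩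
  iter f d y                  ≡⟨ fᵈy≡y ⟩
  y                           ∎

module FixedPoint {A : Set} {f : A → A} {r : A} (f-r : f r ≡ r) where

  iter-fixed : ∀ t → iter f t r ≡ r
  iter-fixed zero    = refl
  iter-fixed (suc t) = trans (cong f (iter-fixed t)) f-r

  iter-stays : ∀ {m k x} → iter f m x ≡ r → m ≤ k → iter f k x ≡ r
  iter-stays {m} {k} {x} fᵐx≡r m≤k = begin
    iter f k x                    ≡⟨ cong (λ t → iter f t x) (sym (m∸n+n≡m m≤k)) ⟩
    iter f (k ∸ m + m) x          ≡⟨ iter-+ f (k ∸ m) m x ⟩
    iter f (k ∸ m) (iter f m x)   ≡⟨ cong (iter f (k ∸ m)) fᵐx≡r ⟩
    iter f (k ∸ m) r              ≡⟨ iter-fixed (k ∸ m) ⟩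
    r                             ∎

  periodic-reaching⇒fixed : ∀ d m {y} → iter f (suc d) y ≡ y → iter f m y ≡ r → y ≡ r
  periodic-reaching⇒fixed d m {y} periodic fᵐy≡r =
    trans (sym (iter-periodic f periodic m)) (iter-stays fᵐy≡r (m≤m*n m (suc d)))

  -- A repetition j < k on the orbit of x makes f^j x periodic.
  repeat⇒fixed : ∀ m {j k x} → iter f m x ≡ r → j < k → iter f j x ≡ iter f k x → iter f j x ≡ r
  repeat⇒fixed m {j} {k} {x} fᵐx≡r j<k fʲx≡fᵏx =
    periodic-reaching⇒fixed (k ∸ suc j) m periodic (trans (sym (iter-+ f m j x)) (iter-stays fᵐx≡r (m≤m+n m j)))
    where
    periodic : iter f (suc (k ∸ suc j)) (iter f j x) ≡ iter f j x
    periodic = begin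
      iter f (suc (k ∸ suc j)) (iter f j x)     ≡⟨ sym (iter-+ f (suc (k ∸ suc j)) j x) ⟩
      iter f (suc (k ∸ suc j + j)) x            ≡⟨ cong (λ t → iter f t x) (sym (+-suc (k ∸ suc j) j)) ⟩
      iter f (k ∸ suc j + suc j) x              ≡⟨ cong (λ t → iter f t x) (m∸n+n≡m j<k) ⟩
      iter f k x                                ≡⟨ sym fʲx≡fᵏx ⟩
      iter f j x                                ∎

iter-reaches-within : ∀ {n} {p : Fin n → Fin n} {r} m {x} →
  p r ≡ r → iter p m x ≡ r → iter p n x ≡ r
iter-reaches-within {n} {p} {r} m {x} p-r pᵐx≡r
  with i , j , i<j , repeat ← pigeonhole (n<1+n n) (λ (i : Fin (suc n)) → iter p (toℕ i) x) =
  iter-stays (repeat⇒fixed m pᵐx≡r i<j repeat) (toℕ≤pred[n] i)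
  where open FixedPoint {f = p} p-r

xorUpTo : (ℕ → Bool) → ℕ → Bool
xorUpTo f zero    = false
xorUpTo f (suc k) = f k xor xorUpTo f k

xorUpTo-telescope : ∀ (f : ℕ → Bool) k → xorUpTo (λ j → f j xor f (suc j)) k ≡ f 0 xor f k
xorUpTo-telescope f zero    = sym (xor-same (f 0))
xorUpTo-telescope f (suc k) = begin
  (f k xor f (suc k)) xor xorUpTo (λ j → f j xor f (suc j)) k
    ≡⟨ cong ((f k xor f (suc k)) xor_) (xorUpTo-telescope f k) ⟩
  (f k xor f (suc k)) xor (f 0 xor f k)
    ≡⟨ xor-comm (f k xor f (suc k)) _ ⟩
  (f 0 xor f k) xor (f k xor f (suc k))
    ≡⟨ xor-assoc (f 0) (f k) _ ⟩
  f 0 xor (f k xor (f k xor f (suc k)))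
    ≡⟨ cong (f 0 xor_) (sym (xor-assoc (f k) (f k) _)) ⟩
  f 0 xor ((f k xor f k) xor f (suc k))
    ≡⟨ cong (λ b → f 0 xor (b xor f (suc k))) (xor-same (f k)) ⟩
  f 0 xor f (suc k)
    ∎

xorUpTo-cong : ∀ {f g : ℕ → Bool} → (∀ j → f j ≡ g j) → ∀ k → xorUpTo f k ≡ xorUpTo g k
xorUpTo-cong f≗g zero    = refl
xorUpTo-cong f≗g (suc k) = cong₂ _xor_ (f≗g k) (xorUpTo-cong f≗g k)

∧-distribˡ-xorUpTo : ∀ b (f : ℕ → Bool) k → b ∧ xorUpTo f k ≡ xorUpTo (λ j → b ∧ f j) k
∧-distribˡ-xorUpTo b f zero    = ∧-zeroʳ b
∧-distribˡ-xorUpTo b f (suc k) =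
  trans (∧-distribˡ-xor b (f k) _) (cong ((b ∧ f k) xor_) (∧-distribˡ-xorUpTo b f k))

∑-xorUpTo : ∀ {n} (g : Fin n → ℕ → Bool) k →
  ∑[ v < n ] xorUpTo (g v) k ≡ xorUpTo (λ j → ∑[ v < n ] g v j) k
∑-xorUpTo {n} g zero    = sum-replicate-zero n
∑-xorUpTo {n} g (suc k) =
  trans (∑-distrib-+ (λ v → g v k) (λ v → xorUpTo (g v) k)) (cong ((∑[ v < n ] g v k) xor_) (∑-xorUpTo g k))

∑-select : ∀ {n} (b : Fin n → Bool) u → ∑[ v < n ] (b v ∧ does (u ≟ v)) ≡ b u
∑-select {suc n} b zero = begin
  (b zero ∧ true) xor ∑[ v < n ] (b (suc v) ∧ false) ≡⟨ cong₂ _xor_ (∧-identityʳ (b zero)) (sum-cong-≗ (∧-zeroʳ ∘ b ∘ suc)) ⟩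
  b zero xor ∑[ v < n ] false                          ≡⟨ cong (b zero xor_) (sum-replicate-zero n) ⟩
  b zero xor false                                     ≡⟨ xor-identityʳ (b zero) ⟩
  b zero                                               ∎
∑-select {suc n} b (suc u) =
  trans (cong (_xor ∑[ v < n ] (b (suc v) ∧ does (u ≟ v))) (∧-zeroʳ (b zero))) (∑-select (b ∘ suc) u)

isAncestorWithin⇒iter : ∀ {n} (p : Fin n → Fin n) k v w →
  isAncestorWithin p k v w ≡ true → ∃ λ j → j < k × iter p j w ≡ v
isAncestorWithin⇒iter p (suc k) v w anc with iter p k w ≟ v
... | yes pᵏw≡v = k , n<1+n k , pᵏw≡v
... | no _ with j , j<k , pʲw≡v ← isAncestorWithin⇒iter p k v w anc = j , m≤n⇒m≤1+n j<k , pʲw≡v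

-- The disjunction in isAncestorWithin is exclusive: before reaching the root, the orbit of w
-- visits no vertex twice.
isAncestorWithin≡xorUpTo : ∀ {n} {p : Fin n → Fin n} {r} m {w v} →
  p r ≡ r → iter p m w ≡ r → ¬ v ≡ r →
  ∀ k → isAncestorWithin p k v w ≡ xorUpTo (λ j → does (iter p j w ≟ v)) k
isAncestorWithin≡xorUpTo m p-r pᵐw≡r v≢r zero = refl
isAncestorWithin≡xorUpTo {p = p} m {w} {v} p-r pᵐw≡r v≢r (suc k)
  with iter p k w ≟ v | isAncestorWithin≡xorUpTo m p-r pᵐw≡r v≢r k
... | no _       | anc≡xor = anc≡xor
... | yes pᵏw≡v  | anc≡xor with isAncestorWithin p k v w in anc
...   | false = cong not anc≡xor
...   | true with j , j<k , pʲw≡v ← isAncestorWithin⇒iter p k v w anc =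
  ⊥-elim (v≢r (trans (sym pʲw≡v) (repeat⇒fixed m pᵐw≡r j<k (trans pʲw≡v (sym pᵏw≡v)))))
  where open FixedPoint {f = p} p-r

lookup-foldr-⊕ : ∀ {m n k} (F : Fin k → Subset n) (g : Fin m → Fin k) w →
  lookup (foldr (λ _ → Subset n) (λ v acc → F v ⊕ acc) ⊥ (tabulate g)) w
    ≡ ∑[ i < m ] lookup (F (g i)) w
lookup-foldr-⊕ {zero}  F g w = lookup-replicate w false
lookup-foldr-⊕ {suc m} F g w =
  trans (lookup-zipWith _xor_ w (F (g zero)) _) (cong (lookup (F (g zero)) w xor_) (lookup-foldr-⊕ F (g ∘ suc) w))

lookup-if-⊥ : ∀ {n} b (X : Subset n) w → lookup (if b then X else ⊥) w ≡ b ∧ lookup X w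
lookup-if-⊥ true  X w = refl
lookup-if-⊥ false X w = lookup-replicate w false

lookup-⨁desc : ∀ {n} {G : Graph n} (T : RootedSpanningTree G) S w →
  lookup (⨁desc T S) w ≡ ∑[ v < n ] (lookup S v ∧ isAncestorWithin (RootedSpanningTree.parent T) n v w)
lookup-⨁desc {n} T S w =
  trans (lookup-foldr-⊕ (λ v → if lookup S v then desc T v else ⊥) (λ v → v) w) (sum-cong-≗ λ v →
    trans (lookup-if-⊥ (lookup S v) (desc T v) w) (cong (lookup S v ∧_) (lookup∘tabulate _ w)))

lookup-ext : ∀ {A : Set} {n} {xs ys : Vec A n} → (∀ i → lookup xs i ≡ lookup ys i) → xs ≡ ys
lookup-ext {xs = xs} {ys} eq = trans (sym (tabulate∘lookup xs)) (trans (tabulate-cong eq) (tabulate∘lookup ys))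

≡⊎∁≡ : ∀ {n} (A B : Subset n) c → (∀ w → lookup B w ≡ lookup A w xor c) → A ≡ B ⊎ ∁ A ≡ B
≡⊎∁≡ A B false B≡A⊕c = inj₁ (lookup-ext λ w → sym (trans (B≡A⊕c w) (xor-identityʳ _)))
≡⊎∁≡ A B true  B≡A⊕c = inj₂ (lookup-ext λ w →
  trans (lookup-map w not A) (sym (trans (B≡A⊕c w) (trans (xor-comm _ true) (true-xor _)))))

module _ {n} {G : Graph n} (T : RootedSpanningTree G) (A : Subset n) where
  open RootedSpanningTree T

  cut : Fin n → Bool
  cut v = lookup A v xor lookup A (parent v)

  cut-root : cut root ≡ false
  cut-root = trans (cong (λ u → lookup A root xor lookup A u) parent-root) (xor-same (lookup A root))

  root∉cut : root ∉ tabulate cut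
  root∉cut root∈cut with trans (sym cut-root) (trans (sym (lookup∘tabulate cut root)) ([]=⇒lookup root∈cut))
  ... | ()

  lookup-⨁desc-cut : ∀ w → lookup (⨁desc T (tabulate cut)) w ≡ lookup A w xor lookup A root
  lookup-⨁desc-cut w = begin
    lookup (⨁desc T (tabulate cut)) w
      ≡⟨ lookup-⨁desc T (tabulate cut) w ⟩
    ∑[ v < n ] (lookup (tabulate cut) v ∧ isAncestorWithin parent n v w)
      ≡⟨ sum-cong-≗ (λ v → cong (_∧ isAncestorWithin parent n v w) (lookup∘tabulate cut v)) ⟩
    ∑[ v < n ] (cut v ∧ isAncestorWithin parent n v w)
      ≡⟨ sum-cong-≗ on-path ⟩
    ∑[ v < n ] (cut v ∧ xorUpTo (λ j → does (orbit j ≟ v)) n)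
      ≡⟨ sum-cong-≗ (λ v → ∧-distribˡ-xorUpTo (cut v) (λ j → does (orbit j ≟ v)) n) ⟩
    ∑[ v < n ] xorUpTo (λ j → cut v ∧ does (orbit j ≟ v)) n
      ≡⟨ ∑-xorUpTo (λ v j → cut v ∧ does (orbit j ≟ v)) n ⟩
    xorUpTo (λ j → ∑[ v < n ] (cut v ∧ does (orbit j ≟ v))) n
      ≡⟨ xorUpTo-cong (λ j → ∑-select cut (orbit j)) n ⟩
    xorUpTo (λ j → cut (orbit j)) n
      ≡⟨ xorUpTo-telescope (λ j → lookup A (orbit j)) n ⟩
    lookup A w xor lookup A (orbit n)
      ≡⟨ cong (λ u → lookup A w xor lookup A u) (iter-reaches-within m parent-root pᵐw≡root) ⟩
    lookup A w xor lookup A root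
      ∎
    where
    orbit : ℕ → Fin n
    orbit j = iter parent j w

    m : ℕ
    m = proj₁ (reaches-root w)

    pᵐw≡root : iter parent m w ≡ root
    pᵐw≡root = proj₂ (reaches-root w)

    on-path : ∀ v → cut v ∧ isAncestorWithin parent n v w ≡ cut v ∧ xorUpTo (λ j → does (orbit j ≟ v)) n
    on-path v with v ≟ root
    ... | yes refl rewrite cut-root = refl
    ... | no v≢root = cong (cut v ∧_) (isAncestorWithin≡xorUpTo m parent-root pᵐw≡root v≢root n)

proposition3p1 : (n : ℕ) (G : Graph n) (T : RootedSpanningTree G) (A : Subset n) →
    ∃ λ (S : Subset n) → RootedSpanningTree.root T ∉ S ×
    (A ≡ ⨁desc T S ⊎ ∁ A ≡ ⨁desc T S)
proposition3p1 n G T A =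
  tabulate (cut T A) ,
  root∉cut T A ,
  ≡⊎∁≡ A (⨁desc T (tabulate (cut T A))) (lookup A (RootedSpanningTree.root T)) (lookup-⨁desc-cut T A)
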